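{- If $G$ is a plane graph with at most $7$ triangular faces, then $\mathrm{m}(G)\leq 3$.
   Context: All graphs are finite, simple and undirected. A plane graph is a graph embedded in the plane; a triangular face is a face whose boundary has length $3$. A $k$-list assignment $L$ to $G$ assigns to each vertex $v$ a set $L(v)$ of exactly $k$ colors; an $L$-coloring is a proper coloring $c$ with $c(v)\in L(v)$ for all $v$. $G$ is uniquely $k$-list colorable if some $k$-list assignment $L$ admits exactly one $L$-coloring of $G$. The m-number $\mathrm{m}(G)$ is the minimum positive integer $k$ such that $G$ is not uniquely $k$-list colorable. -}

module Defs where

open import Data.Nat using (ℕ; zero; suc; _+_; _*_; _≤_; _<_)
open import Data.Fin using (Fin)
open import Data.Bool using (Bool; true; false)
open import Data.List using (List; length)
open import Data.List.Membership.Propositional using (_∈_)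
open import Data.List.Relation.Unary.Unique.Propositional using (Unique)
open import Data.Maybe using (Maybe; just; nothing)
open import Data.Product using (Σ; ∃; _×_; _,_; proj₁; proj₂)
open import Data.Sum using (_⊎_; inj₁; inj₂)
open import Data.Unit using (⊤; tt)
open import Function using (_∘_)
open import Relation.Nullary using (¬_)
open import Relation.Binary.PropositionalEquality using (_≡_; _≢_; refl; trans; sym; subst)

record Graph (n : ℕ) : Set where
  field
    adj    : Fin n → Fin n → Bool
    adj-sym : ∀ u v → adj u v ≡ adj v u
    irrefl  : ∀ v → adj v v ≡ false

module _ {n : ℕ} (G : Graph n) where
  open Graph G

  Adj : Fin n → Fin n → Set
  Adj u v = adj u v ≡ true

  Adj-sym : ∀ {u v} → Adj u v → Adj v u
  Adj-sym {u} {v} p = trans (adj-sym v u) p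

  data Reach : Fin n → Fin n → Set where
    here : ∀ {v} → Reach v v
    step : ∀ {u w v} → Adj u w → Reach w v → Reach u v

  Dart : Set
  Dart = Σ (Fin n × Fin n) (λ p → Adj (proj₁ p) (proj₂ p))

  Isolated : Fin n → Set
  Isolated v = ∀ u → ¬ Adj v u

-- Counting the classes of a relation: R has exactly k classes on A,
-- witnessed by a surjective labelling A → Fin k whose kernel is R.

record Classify (A : Set) (R : A → A → Set) (k : ℕ) : Set where
  field
    cls      : A → Fin k
    surj     : ∀ i → ∃ λ a → cls a ≡ i
    sound    : ∀ a b → cls a ≡ cls b → R a b
    complete : ∀ a b → R a b → cls a ≡ cls b

iter : {A : Set} → (A → A) → ℕ → A → A
iter f zero    x = x
iter f (suc k) x = f (iter f k x)

-- * A rotation system: at every vertex v, a cyclic order (rot v) of the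
--   neighbours of v.  The face-tracing map on darts is
--   φ (u , v) = (v , rot v u); its orbits are the facial walks of the
--   cellular embeddings of the components on the sphere.
-- * Every component is embedded in the sphere (genus 0), expressed by
--   the Euler relation  V + F' + I = 2C + E  where F' = number of
--   φ-orbits, I = number of isolated vertices, C = number of components
--   (each component with edges satisfies V_c - E_c + F_c = 2 - 2 g_c,
--   each isolated vertex contributes 1 - 0 + 0 = 1).
-- * The relative position of the components in the plane: every
--   component with edges chooses an "outer" facial walk (the one facing
--   its surroundings), and every component is placed either in the
--   unbounded region (nothing) or inside a non-outer facial walk of a
--   component of strictly smaller depth.
-- The faces of the plane graph are then: one face for every φ-orbit
-- that is not an outer walk (its boundary = that walk + the outer walks
-- of the components placed inside it), and the unbounded face (whose
-- boundary = the outer walks of the top-level components).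

record PlaneEmbedding {n : ℕ} (G : Graph n) : Set where
  field
    rot      : Fin n → Fin n → Fin n
    rot-adj  : ∀ v u → Adj G v u → Adj G v (rot v u)
    rot-inj  : ∀ v u w → Adj G v u → Adj G v w → rot v u ≡ rot v w → u ≡ w
    rot-cyc  : ∀ v u w → Adj G v u → Adj G v w → ∃ λ k → iter (rot v) k u ≡ w

  φ : Dart G → Dart G
  φ ((u , v) , p) = (v , rot v u) , rot-adj v u (Adj-sym G p)

  SameFace : Dart G → Dart G → Set
  SameFace d d' = ∃ λ k → proj₁ (iter φ k d) ≡ proj₁ d'

  field
    C  : ℕ
    F′ : ℕ
    E  : ℕ
    I  : ℕ
    comps    : Classify (Fin n) (Reach G) C
    faces    : Classify (Dart G) SameFace F′
    darts    : Classify (Dart G) (λ d d' → proj₁ d ≡ proj₁ d') (2 * E)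
    isolated : Classify (Σ (Fin n) (Isolated G)) (λ a b → proj₁ a ≡ proj₁ b) I
    euler    : n + F′ + I ≡ 2 * C + E

  compOf : Fin n → Fin C
  compOf = Classify.cls comps

  faceOf : Dart G → Fin F′
  faceOf = Classify.cls faces

  Edgeless : Fin C → Set
  Edgeless c = ∀ v → compOf v ≡ c → Isolated G v

  FaceLen3 : Fin F′ → Set
  FaceLen3 f = ∀ d → faceOf d ≡ f → proj₁ (iter φ 3 d) ≡ proj₁ d

  field
    faceComp    : Fin F′ → Fin C
    faceComp-ok : ∀ d → faceComp (faceOf d) ≡ compOf (proj₁ (proj₁ d))
    outer       : Fin C → Maybe (Fin F′)
    outer-comp  : ∀ c f → outer c ≡ just f → faceComp f ≡ c
    outer-edges : ∀ c → outer c ≡ nothing → Edgeless c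
    place       : Fin C → Maybe (Fin F′)
    place-other : ∀ c f → place c ≡ just f → faceComp f ≢ c
    place-inner : ∀ c f → place c ≡ just f → ∀ c' → outer c' ≢ just f
    depth       : Fin C → ℕ
    place-depth : ∀ c f → place c ≡ just f → depth (faceComp f) < depth c

  -- bounded triangular faces: a non-outer facial walk of length 3, inside
  -- which only edgeless components (isolated vertices) are placed
  TriInner : Fin F′ → Set
  TriInner f = (∀ c → outer c ≢ just f) × FaceLen3 f
             × (∀ c → place c ≡ just f → Edgeless c)

  -- the unbounded face is triangular: exactly one top-level component has
  -- edges and its outer walk has length 3
  TriUnbounded : Set
  TriUnbounded = Σ (Fin C) λ c → place c ≡ nothing
               × Σ (Fin F′) (λ f → outer c ≡ just f × FaceLen3 f)
               × (∀ c' → place c' ≡ nothing → c' ≢ c → Edgeless c')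

  TriFace : Set
  TriFace = Σ (Fin F′) TriInner ⊎ TriUnbounded

  triKey : TriFace → Maybe (Fin F′)
  triKey (inj₁ (f , _)) = just f
  triKey (inj₂ _)       = nothing

  AtMostTriangular : ℕ → Set
  AtMostTriangular k = ∃ λ (g : TriFace → Fin k) → ∀ x y → g x ≡ g y → triKey x ≡ triKey y

module _ {n : ℕ} (G : Graph n) where

  record ListAssignment (k : ℕ) : Set where
    field
      L        : Fin n → List ℕ
      L-size   : ∀ v → length (L v) ≡ k
      L-unique : ∀ v → Unique (L v)

  IsLColoring : ∀ {k} → ListAssignment k → (Fin n → ℕ) → Set
  IsLColoring La c = (∀ v → c v ∈ ListAssignment.L La v)
                   × (∀ u v → Adj G u v → c u ≢ c v)

  UniquelyListColorable : ℕ → Set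
  UniquelyListColorable k =
    Σ (ListAssignment k) λ La → Σ (Fin n → ℕ) λ c →
      IsLColoring La c × (∀ c' → IsLColoring La c' → ∀ v → c' v ≡ c v)

  IsMNumber : ℕ → Set
  IsMNumber m = 1 ≤ m × ¬ UniquelyListColorable m
              × (∀ k → 1 ≤ k → k < m → UniquelyListColorable k)

-- If G had a unique L-colouring c from 3-element lists, sum the graph polynomial
-- P = Π_{uv ∈ E} (x_u − x_v) over the grid L(v₁) × ⋯ × L(vₙ), weighting each coordinate by the
-- Lagrange weights of its list cleared of denominators.  These weights annihilate 1 and t, so every
-- monomial with an exponent below 2 sums to zero; if |E| < 2n, every monomial of P is of this kind
-- and the sum vanishes.  But P vanishes at improper colourings and c is the only proper grid point,
-- so the sum is a single nonzero term.  Hence |E| ≥ 2n.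
--
-- On the other hand a plane graph with at most 7 triangular faces has |E| < 2n.  Give every facial
-- walk four positions, filled by its first four darts; a walk of length 2 or 3 leaves deficits.
-- Each component owns eight slots, enough to pay for an isolated vertex, or for the deficits of its
-- own outer walk and of the walk it is placed in, while the at most seven triangular faces and one
-- extra token use the remaining spare slots.  Hence 4F + 4I + 1 ≤ 2E + 8C, which Euler's relation
-- n + F + I = 2C + E turns into 2E < 4n.

module Submission where

open import Defs
open import Data.Nat using (ℕ; _≤_; _≤?_; s≤s; z≤n)
open import Data.Nat.Properties using (≰⇒>)
open import Data.Product using (_,_)
open import Relation.Nullary.Decidable using (decidable-stable)

module Graphs where

  open import Relation.Nullary using (¬_)
  open import Relation.Binary.PropositionalEquality

  ¬Adj-refl : ∀ {n} (G : Graph n) {u} → ¬ Adj G u u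
  ¬Adj-refl G {u} uu with trans (sym (Graph.irrefl G u)) uu
  ... | ()

module UniqueLists where

  open import Data.Fin using (zero; suc)
  open import Data.List using (List; _∷_; lookup)
  open import Data.List.Membership.Propositional.Properties using (∈-lookup)
  open import Data.List.Relation.Unary.All as All using ()
  open import Data.List.Relation.Unary.AllPairs using (_∷_)
  open import Data.List.Relation.Unary.Unique.Propositional using (Unique)
  open import Data.Empty using (⊥-elim)
  open import Relation.Binary.PropositionalEquality

  lookup-injective : ∀ {A : Set} {xs : List A} → Unique xs → ∀ i j → lookup xs i ≡ lookup xs j → i ≡ j
  lookup-injective {xs = x ∷ xs} (x∉xs ∷ u) zero    zero    eq = refl
  lookup-injective {xs = x ∷ xs} (x∉xs ∷ u) zero    (suc j) eq = ⊥-elim (All.lookup x∉xs (∈-lookup j) eq)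
  lookup-injective {xs = x ∷ xs} (x∉xs ∷ u) (suc i) zero    eq = ⊥-elim (All.lookup x∉xs (∈-lookup i) (sym eq))
  lookup-injective {xs = x ∷ xs} (x∉xs ∷ u) (suc i) (suc j) eq = cong suc (lookup-injective u i j eq)

module SumInjections where

  open import Data.Sum using (inj₁; inj₂; [_,_]; map₂)
  open import Data.Sum.Properties using (inj₁-injective; inj₂-injective)
  open import Function.Definitions using (Injective)
  open import Data.Empty using (⊥-elim)
  open import Relation.Binary.PropositionalEquality hiding ([_])

  inj₁≢inj₂ : ∀ {A B : Set} {a : A} {b : B} → inj₁ a ≢ inj₂ b
  inj₁≢inj₂ ()

  module _ {A B C : Set} where

    map₂-injective : ∀ {g : B → C} → Injective _≡_ _≡_ g → Injective _≡_ _≡_ (map₂ {A = A} g)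
    map₂-injective g-inj {inj₁ a} {inj₁ a′} eq = cong inj₁ (inj₁-injective eq)
    map₂-injective g-inj {inj₂ b} {inj₂ b′} eq = cong inj₂ (g-inj (inj₂-injective eq))
    map₂-injective g-inj {inj₁ a} {inj₂ b′} ()
    map₂-injective g-inj {inj₂ b} {inj₁ a′} ()

    [,]-injective : ∀ {f : A → C} {g : B → C} → Injective _≡_ _≡_ f → Injective _≡_ _≡_ g →
      (∀ a b → f a ≢ g b) → Injective _≡_ _≡_ [ f , g ]
    [,]-injective f-inj g-inj disjoint {inj₁ a} {inj₁ a′} eq = cong inj₁ (f-inj eq)
    [,]-injective f-inj g-inj disjoint {inj₂ b} {inj₂ b′} eq = cong inj₂ (g-inj eq)
    [,]-injective f-inj g-inj disjoint {inj₁ a} {inj₂ b′} eq = ⊥-elim (disjoint a b′ eq)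
    [,]-injective f-inj g-inj disjoint {inj₂ b} {inj₁ a′} eq = ⊥-elim (disjoint a′ b (sym eq))

module Iteration where

  open import Data.Nat using (zero; suc; _+_)
  import Data.Nat.Properties as ℕ
  open import Relation.Binary.PropositionalEquality

  module _ {A : Set} (f : A → A) where

    iter-+ : ∀ i j x → iter f (i + j) x ≡ iter f i (iter f j x)
    iter-+ zero    j x = refl
    iter-+ (suc i) j x = cong f (iter-+ i j x)

    iter-comm : ∀ i j x → iter f i (iter f j x) ≡ iter f j (iter f i x)
    iter-comm i j x = trans (sym (iter-+ i j x)) (trans (cong (λ k → iter f k x) (ℕ.+-comm i j)) (iter-+ j i x))

    iter-fixedPoint : ∀ {x} → f x ≡ x → ∀ k → iter f k x ≡ x
    iter-fixedPoint fx≡x zero    = refl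
    iter-fixedPoint fx≡x (suc k) = trans (cong f (iter-fixedPoint fx≡x k)) fx≡x

    iter-injective : (∀ {x y} → f x ≡ f y → x ≡ y) → ∀ k {x y} → iter f k x ≡ iter f k y → x ≡ y
    iter-injective f-inj zero    eq = eq
    iter-injective f-inj (suc k) eq = iter-injective f-inj k (f-inj eq)

    iter-cancel : (∀ {x y} → f x ≡ f y → x ≡ y) →
      ∀ i k x → iter f i x ≡ iter f (i + k) x → iter f k x ≡ x
    iter-cancel f-inj i k x eq = sym (iter-injective f-inj i (trans eq (iter-+ i k x)))

module GridSums where

  open import Data.Nat as ℕ using (ℕ; zero; suc; _<_; _≤_; s≤s)
  import Data.Nat.Properties as ℕ
  open import Data.Fin using (Fin; zero; suc)
  open import Data.Integer using (ℤ; +_; _-_; _*_; _+_; _^_)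
  import Data.Integer.Properties as ℤ
  open import Data.Integer.Tactic.RingSolver using (solve-∀)
  open import Data.Vec.Functional as Vec using (Vector; head; tail; foldr; updateAt)
  open import Data.List using (List; []; _∷_; length)
  open import Data.List.Membership.Propositional using (_∈_)
  open import Data.List.Relation.Unary.Any using (here; there)
  open import Data.Product using (_×_; _,_; proj₁; proj₂)
  open import Data.Sum using (inj₁; inj₂)
  open import Function using (_∘_)
  open import Relation.Nullary using (¬_; Dec; yes; no)
  open import Relation.Binary.PropositionalEquality
  open ≡-Reasoning

  Σ₃ : (Fin 3 → ℤ) → ℤ
  Σ₃ h = h zero + (h (suc zero) + h (suc (suc zero)))

  Σ₃-cong : ∀ {h h′ : Fin 3 → ℤ} → (∀ i → h i ≡ h′ i) → Σ₃ h ≡ Σ₃ h′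
  Σ₃-cong h≗h′ = cong₂ _+_ (h≗h′ zero) (cong₂ _+_ (h≗h′ (suc zero)) (h≗h′ (suc (suc zero))))

  Σ₃-supportedAt : ∀ (h : Fin 3 → ℤ) i₀ → (∀ i → i ≢ i₀ → h i ≡ + 0) → Σ₃ h ≡ h i₀
  Σ₃-supportedAt h zero off
    rewrite off (suc zero) (λ ()) | off (suc (suc zero)) (λ ()) = ℤ.+-identityʳ (h zero)
  Σ₃-supportedAt h (suc zero) off
    rewrite off zero (λ ()) | off (suc (suc zero)) (λ ()) = trans (ℤ.+-identityˡ _) (ℤ.+-identityʳ _)
  Σ₃-supportedAt h (suc (suc zero)) off
    rewrite off zero (λ ()) | off (suc zero) (λ ()) = trans (ℤ.+-identityˡ _) (ℤ.+-identityˡ _)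

  Σ₃-*ʳ : ∀ (a b : Fin 3 → ℤ) k → Σ₃ (λ i → a i * (b i * k)) ≡ Σ₃ (λ i → a i * b i) * k
  Σ₃-*ʳ a b k = expanded (a zero) (a (suc zero)) (a (suc (suc zero)))
                      (b zero) (b (suc zero)) (b (suc (suc zero))) k
    where
    expanded : ∀ a₀ a₁ a₂ b₀ b₁ b₂ k →
      a₀ * (b₀ * k) + (a₁ * (b₁ * k) + a₂ * (b₂ * k)) ≡ (a₀ * b₀ + (a₁ * b₁ + a₂ * b₂)) * k
    expanded = solve-∀

  Σ₃-*ˡ : ∀ (a b : Fin 3 → ℤ) k → Σ₃ (λ i → a i * (k * b i)) ≡ k * Σ₃ (λ i → a i * b i)
  Σ₃-*ˡ a b k = expanded (a zero) (a (suc zero)) (a (suc (suc zero)))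
                      (b zero) (b (suc zero)) (b (suc (suc zero))) k
    where
    expanded : ∀ a₀ a₁ a₂ b₀ b₁ b₂ k →
      a₀ * (k * b₀) + (a₁ * (k * b₁) + a₂ * (k * b₂)) ≡ k * (a₀ * b₀ + (a₁ * b₁ + a₂ * b₂))
    expanded = solve-∀

  Σ₃-- : ∀ (a b c : Fin 3 → ℤ) →
    Σ₃ (λ i → a i * (b i - c i)) ≡ Σ₃ (λ i → a i * b i) - Σ₃ (λ i → a i * c i)
  Σ₃-- a b c = expanded (a zero) (a (suc zero)) (a (suc (suc zero)))
                     (b zero) (b (suc zero)) (b (suc (suc zero)))
                     (c zero) (c (suc zero)) (c (suc (suc zero)))
    where
    expanded : ∀ a₀ a₁ a₂ b₀ b₁ b₂ c₀ c₁ c₂ →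
      a₀ * (b₀ - c₀) + (a₁ * (b₁ - c₁) + a₂ * (b₂ - c₂))
        ≡ (a₀ * b₀ + (a₁ * b₁ + a₂ * b₂)) - (a₀ * c₀ + (a₁ * c₁ + a₂ * c₂))
    expanded = solve-∀

  gridSum : ∀ {n} → Vector (Fin 3 → ℤ) n → (Vector (Fin 3) n → ℤ) → ℤ
  gridSum {zero}  W F = F Vec.[]
  gridSum {suc n} W F = Σ₃ λ i → W zero i * gridSum (tail W) (F ∘ (i Vec.∷_))

  gridWeight : ∀ {n} → Vector (Fin 3 → ℤ) n → Vector (Fin 3) n → ℤ
  gridWeight W ι = foldr _*_ (+ 1) (λ v → W v (ι v))

  gridSum-cong : ∀ {n} (W : Vector (Fin 3 → ℤ) n) {F G} → (∀ ι → F ι ≡ G ι) →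
    gridSum W F ≡ gridSum W G
  gridSum-cong {zero}  W F≗G = F≗G Vec.[]
  gridSum-cong {suc n} W F≗G =
    Σ₃-cong λ i → cong (W zero i *_) (gridSum-cong (tail W) (F≗G ∘ (i Vec.∷_)))

  gridSum-*ˡ : ∀ {n} (W : Vector (Fin 3 → ℤ) n) k F → gridSum W (λ ι → k * F ι) ≡ k * gridSum W F
  gridSum-*ˡ {zero}  W k F = refl
  gridSum-*ˡ {suc n} W k F = begin
    Σ₃ (λ i → W zero i * gridSum (tail W) (λ ι → k * F (i Vec.∷ ι)))
      ≡⟨ Σ₃-cong (λ i → cong (W zero i *_) (gridSum-*ˡ (tail W) k (F ∘ (i Vec.∷_)))) ⟩
    Σ₃ (λ i → W zero i * (k * gridSum (tail W) (F ∘ (i Vec.∷_))))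
      ≡⟨ Σ₃-*ˡ (W zero) (λ i → gridSum (tail W) (F ∘ (i Vec.∷_))) k ⟩
    k * gridSum W F ∎

  gridSum-- : ∀ {n} (W : Vector (Fin 3 → ℤ) n) F G →
    gridSum W (λ ι → F ι - G ι) ≡ gridSum W F - gridSum W G
  gridSum-- {zero}  W F G = refl
  gridSum-- {suc n} W F G = begin
    Σ₃ (λ i → W zero i * gridSum (tail W) (λ ι → F (i Vec.∷ ι) - G (i Vec.∷ ι)))
      ≡⟨ Σ₃-cong (λ i → cong (W zero i *_) (gridSum-- (tail W) (F ∘ (i Vec.∷_)) (G ∘ (i Vec.∷_)))) ⟩
    Σ₃ (λ i → W zero i * (rest F i - rest G i))
      ≡⟨ Σ₃-- (W zero) (rest F) (rest G) ⟩
    gridSum W F - gridSum W G ∎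
    where
    rest : (Vector (Fin 3) (suc n) → ℤ) → Fin 3 → ℤ
    rest H i = gridSum (tail W) (H ∘ (i Vec.∷_))

  gridSum-zero : ∀ {n} (W : Vector (Fin 3 → ℤ) n) F → (∀ ι → F ι ≡ + 0) → gridSum W F ≡ + 0
  gridSum-zero W F F≗0 = begin
    gridSum W F                   ≡⟨ gridSum-cong W F≗0 ⟩
    gridSum W (λ _ → + 0 * + 0)   ≡⟨ gridSum-*ˡ W (+ 0) (λ _ → + 0) ⟩
    + 0 * gridSum W (λ _ → + 0)   ≡⟨⟩
    + 0                           ∎

  gridSum-supportedAt : ∀ {n} (W : Vector (Fin 3 → ℤ) n) F (ι₀ : Vector (Fin 3) n) K →
    (∀ ι → (∀ v → ι v ≡ ι₀ v) → F ι ≡ K) → (∀ ι → ¬ (∀ v → ι v ≡ ι₀ v) → F ι ≡ + 0) →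
    gridSum W F ≡ K * gridWeight W ι₀
  gridSum-supportedAt {zero}  W F ι₀ K on off = trans (on Vec.[] (λ ())) (sym (ℤ.*-identityʳ K))
  gridSum-supportedAt {suc n} W F ι₀ K on off = begin
    Σ₃ (λ i → W zero i * gridSum (tail W) (F ∘ (i Vec.∷_)))
      ≡⟨ Σ₃-supportedAt _ (head ι₀) elsewhere ⟩
    W zero (head ι₀) * gridSum (tail W) (F ∘ (head ι₀ Vec.∷_))
      ≡⟨ cong (W zero (head ι₀) *_) (gridSum-supportedAt (tail W) _ (tail ι₀) K on′ off′) ⟩
    W zero (head ι₀) * (K * gridWeight (tail W) (tail ι₀))
      ≡⟨ swap (W zero (head ι₀)) K (gridWeight (tail W) (tail ι₀)) ⟩
    K * gridWeight W ι₀ ∎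
    where
    swap : ∀ a b c → a * (b * c) ≡ b * (a * c)
    swap = solve-∀
    elsewhere : ∀ i → i ≢ head ι₀ → W zero i * gridSum (tail W) (F ∘ (i Vec.∷_)) ≡ + 0
    elsewhere i i≢ = trans (cong (W zero i *_) (gridSum-zero (tail W) _ λ ι → off _ (λ eq → i≢ (eq zero))))
                           (ℤ.*-zeroʳ (W zero i))
    on′ : ∀ ι → (∀ v → ι v ≡ tail ι₀ v) → F (head ι₀ Vec.∷ ι) ≡ K
    on′ ι eq = on _ λ { zero → refl ; (suc v) → eq v }
    off′ : ∀ ι → ¬ (∀ v → ι v ≡ tail ι₀ v) → F (head ι₀ Vec.∷ ι) ≡ + 0
    off′ ι neq = off _ λ eq → neq (eq ∘ suc)

  product-nonzero : ∀ {n} (xs : Vector ℤ n) → (∀ v → xs v ≢ + 0) → foldr _*_ (+ 1) xs ≢ + 0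
  product-nonzero {zero}  xs xs≢0 ()
  product-nonzero {suc n} xs xs≢0 eq with ℤ.i*j≡0⇒i≡0∨j≡0 (head xs) eq
  ... | inj₁ head≡0 = xs≢0 zero head≡0
  ... | inj₂ rest≡0 = product-nonzero (tail xs) (xs≢0 ∘ suc) rest≡0

  -- weight t i = − V / Π_{j ≠ i} (t i − t j) with V = (t₀ − t₁)(t₁ − t₂)(t₂ − t₀): the Lagrange
  -- weights cleared of denominators.
  weight : (Fin 3 → ℕ) → Fin 3 → ℤ
  weight t zero             = + t (suc zero) - + t (suc (suc zero))
  weight t (suc zero)       = + t (suc (suc zero)) - + t zero
  weight t (suc (suc zero)) = + t zero - + t (suc zero)

  weight-annihilates : ∀ t k → k ≤ 1 → Σ₃ (λ i → weight t i * (+ t i) ^ k) ≡ + 0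
  weight-annihilates t 0 _ = constant (+ t zero) (+ t (suc zero)) (+ t (suc (suc zero)))
    where
    constant : ∀ a b c → (b - c) * + 1 + ((c - a) * + 1 + (a - b) * + 1) ≡ + 0
    constant = solve-∀
  weight-annihilates t 1 _ = linear (+ t zero) (+ t (suc zero)) (+ t (suc (suc zero)))
    where
    linear : ∀ a b c → (b - c) * (a * + 1) + ((c - a) * (b * + 1) + (a - b) * (c * + 1)) ≡ + 0
    linear = solve-∀
  weight-annihilates t (suc (suc k)) (s≤s ())

  difference-nonzero : ∀ {a b} → a ≢ b → + a - + b ≢ + 0
  difference-nonzero a≢b eq = a≢b (ℤ.+-injective (ℤ.i-j≡0⇒i≡j _ _ eq))

  module _ (t : Fin 3 → ℕ) (t-injective : ∀ i j → t i ≡ t j → i ≡ j) where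

    entries-differ : ∀ i j → i ≢ j → + t i - + t j ≢ + 0
    entries-differ i j i≢j = difference-nonzero (i≢j ∘ t-injective i j)

    weight-nonzero : ∀ i → weight t i ≢ + 0
    weight-nonzero zero             = entries-differ (suc zero) (suc (suc zero)) (λ ())
    weight-nonzero (suc zero)       = entries-differ (suc (suc zero)) zero (λ ())
    weight-nonzero (suc (suc zero)) = entries-differ zero (suc zero) (λ ())

  degree : ∀ {n} → Vector ℕ n → ℕ
  degree = foldr ℕ._+_ 0

  monomial : ∀ {n} → Vector ℕ n → Vector ℕ n → ℤ
  monomial d x = foldr _*_ (+ 1) (λ v → (+ x v) ^ d v)

  degree-updateAt-suc : ∀ {n} (d : Vector ℕ n) u → degree (updateAt d u suc) ≡ suc (degree d)
  degree-updateAt-suc d zero    = refl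
  degree-updateAt-suc d (suc u) = trans (cong (head d ℕ.+_) (degree-updateAt-suc (tail d) u))
                                        (ℕ.+-suc (head d) (degree (tail d)))

  monomial-updateAt-suc : ∀ {n} (d x : Vector ℕ n) u → monomial (updateAt d u suc) x ≡ + x u * monomial d x
  monomial-updateAt-suc d x zero    = ℤ.*-assoc (+ head x) _ _
  monomial-updateAt-suc d x (suc u) = begin
    (+ head x) ^ head d * monomial (updateAt (tail d) u suc) (tail x)
      ≡⟨ cong ((+ head x) ^ head d *_) (monomial-updateAt-suc (tail d) (tail x) u) ⟩
    (+ head x) ^ head d * (+ x (suc u) * monomial (tail d) (tail x))
      ≡⟨ swap ((+ head x) ^ head d) (+ x (suc u)) (monomial (tail d) (tail x)) ⟩
    + x (suc u) * monomial d x ∎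
    where
    swap : ∀ a b c → a * (b * c) ≡ b * (a * c)
    swap = solve-∀

  pick : ∀ {n} → Vector (Fin 3 → ℕ) n → Vector (Fin 3) n → Vector ℕ n
  pick T ι v = T v (ι v)

  gridSum-monomial : ∀ {n} (T : Vector (Fin 3 → ℕ) n) d → degree d < n ℕ.* 2 →
    gridSum (weight ∘ T) (monomial d ∘ pick T) ≡ + 0
  gridSum-monomial {suc n} T d deg<2n = begin
    Σ₃ (λ i → weight (head T) i * gridSum (weight ∘ tail T) (λ ι → power i * rest ι))
      ≡⟨ Σ₃-cong (λ i → cong (weight (head T) i *_) (gridSum-*ˡ (weight ∘ tail T) (power i) rest)) ⟩
    Σ₃ (λ i → weight (head T) i * (power i * restSum))
      ≡⟨ Σ₃-*ʳ (weight (head T)) power restSum ⟩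
    Σ₃ (λ i → weight (head T) i * power i) * restSum
      ≡⟨ vanishes (head d ℕ.≤? 1) ⟩
    + 0 ∎
    where
    power : Fin 3 → ℤ
    power i = (+ head T i) ^ head d
    rest : Vector (Fin 3) n → ℤ
    rest = monomial (tail d) ∘ pick (tail T)
    restSum : ℤ
    restSum = gridSum (weight ∘ tail T) rest
    vanishes : Dec (head d ≤ 1) → Σ₃ (λ i → weight (head T) i * power i) * restSum ≡ + 0
    vanishes (yes d₀≤1) = cong (_* restSum) (weight-annihilates (head T) (head d) d₀≤1)
    vanishes (no d₀≰1)  = trans (cong (Σ₃ (λ i → weight (head T) i * power i) *_)
                                      (gridSum-monomial (tail T) (tail d) rest-degree))
                                (ℤ.*-zeroʳ (Σ₃ (λ i → weight (head T) i * power i)))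
      where
      rest-degree : degree (tail d) < n ℕ.* 2
      rest-degree = ℕ.≤-pred (ℕ.≤-pred
        (ℕ.≤-trans (s≤s (ℕ.+-monoˡ-≤ (degree (tail d)) (ℕ.≰⇒> d₀≰1))) deg<2n))

  edgeProduct : ∀ {n} → List (Fin n × Fin n) → Vector ℕ n → ℤ
  edgeProduct []             x = + 1
  edgeProduct ((u , v) ∷ es) x = (+ x u - + x v) * edgeProduct es x

  gridSum-monomial*edgeProduct : ∀ {n} (T : Vector (Fin 3 → ℕ) n) es d →
    degree d ℕ.+ length es < n ℕ.* 2 →
    gridSum (weight ∘ T) (λ ι → monomial d (pick T ι) * edgeProduct es (pick T ι)) ≡ + 0
  gridSum-monomial*edgeProduct T [] d deg<2n = begin
    gridSum (weight ∘ T) (λ ι → monomial d (pick T ι) * + 1)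
      ≡⟨ gridSum-cong (weight ∘ T) (λ ι → ℤ.*-identityʳ (monomial d (pick T ι))) ⟩
    gridSum (weight ∘ T) (monomial d ∘ pick T)
      ≡⟨ gridSum-monomial T d (subst (_< _) (ℕ.+-identityʳ (degree d)) deg<2n) ⟩
    + 0 ∎
  gridSum-monomial*edgeProduct {n} T ((u , v) ∷ es) d deg<2n = begin
    gridSum (weight ∘ T) (λ ι → monomial d (pick T ι) * edgeProduct ((u , v) ∷ es) (pick T ι))
      ≡⟨ gridSum-cong (weight ∘ T) (λ ι → expand (pick T ι)) ⟩
    gridSum (weight ∘ T) (λ ι → raise u ι - raise v ι)
      ≡⟨ gridSum-- (weight ∘ T) (raise u) (raise v) ⟩
    gridSum (weight ∘ T) (raise u) - gridSum (weight ∘ T) (raise v)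
      ≡⟨ cong₂ _-_ (gridSum-monomial*edgeProduct T es (updateAt d u suc) (raised-degree u))
                   (gridSum-monomial*edgeProduct T es (updateAt d v suc) (raised-degree v)) ⟩
    + 0 - + 0 ∎
    where
    raise : Fin n → Vector (Fin 3) n → ℤ
    raise w ι = monomial (updateAt d w suc) (pick T ι) * edgeProduct es (pick T ι)
    distribute : ∀ m a b p → m * ((a - b) * p) ≡ (a * m) * p - (b * m) * p
    distribute = solve-∀
    expand : ∀ x → monomial d x * ((+ x u - + x v) * edgeProduct es x)
                 ≡ monomial (updateAt d u suc) x * edgeProduct es x
                   - monomial (updateAt d v suc) x * edgeProduct es x
    expand x = trans (distribute (monomial d x) (+ x u) (+ x v) (edgeProduct es x))
                     (cong₂ (λ p q → p * edgeProduct es x - q * edgeProduct es x)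
                            (sym (monomial-updateAt-suc d x u)) (sym (monomial-updateAt-suc d x v)))
    raised-degree : ∀ w → degree (updateAt d w suc) ℕ.+ length es < n ℕ.* 2
    raised-degree w = subst (λ k → k ℕ.+ length es < n ℕ.* 2) (sym (degree-updateAt-suc d w))
                            (subst (_< n ℕ.* 2) (ℕ.+-suc (degree d) (length es)) deg<2n)

  degree-zeros : ∀ n → degree {n} (λ _ → 0) ≡ 0
  degree-zeros zero    = refl
  degree-zeros (suc n) = degree-zeros n

  monomial-zeros : ∀ {n} (x : Vector ℕ n) → monomial (λ _ → 0) x ≡ + 1
  monomial-zeros {zero}  x = refl
  monomial-zeros {suc n} x = trans (ℤ.*-identityˡ _) (monomial-zeros (tail x))

  gridSum-edgeProduct : ∀ {n} (T : Vector (Fin 3 → ℕ) n) es → length es < n ℕ.* 2 →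
    gridSum (weight ∘ T) (edgeProduct es ∘ pick T) ≡ + 0
  gridSum-edgeProduct {n} T es |es|<2n = begin
    gridSum (weight ∘ T) (edgeProduct es ∘ pick T)
      ≡⟨ gridSum-cong (weight ∘ T) one-factor ⟩
    gridSum (weight ∘ T) (λ ι → monomial (λ _ → 0) (pick T ι) * edgeProduct es (pick T ι))
      ≡⟨ gridSum-monomial*edgeProduct T es (λ _ → 0)
           (subst (λ k → k ℕ.+ length es < n ℕ.* 2) (sym (degree-zeros n)) |es|<2n) ⟩
    + 0 ∎
    where
    one-factor : ∀ ι →
      edgeProduct es (pick T ι) ≡ monomial (λ _ → 0) (pick T ι) * edgeProduct es (pick T ι)
    one-factor ι = sym (trans (cong (_* edgeProduct es (pick T ι)) (monomial-zeros (pick T ι)))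
                              (ℤ.*-identityˡ (edgeProduct es (pick T ι))))

  edgeProduct-cong : ∀ {n} es {x y : Vector ℕ n} → (∀ v → x v ≡ y v) →
    edgeProduct es x ≡ edgeProduct es y
  edgeProduct-cong []             x≗y = refl
  edgeProduct-cong ((u , v) ∷ es) x≗y =
    cong₂ _*_ (cong₂ (λ a b → + a - + b) (x≗y u) (x≗y v)) (edgeProduct-cong es x≗y)

  edgeProduct-zero : ∀ {n} {es} (x : Vector ℕ n) {e} → e ∈ es → x (proj₁ e) ≡ x (proj₂ e) →
    edgeProduct es x ≡ + 0
  edgeProduct-zero {es = (u , v) ∷ es} x (here refl) xu≡xv = begin
    (+ x u - + x v) * edgeProduct es x ≡⟨ cong (λ a → (+ a - + x v) * edgeProduct es x) xu≡xv ⟩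
    (+ x v - + x v) * edgeProduct es x ≡⟨ cong (_* edgeProduct es x) (ℤ.+-inverseʳ (+ x v)) ⟩
    + 0                                ∎
  edgeProduct-zero {es = (u , v) ∷ es} x (there e∈es) xu≡xv =
    trans (cong ((+ x u - + x v) *_) (edgeProduct-zero x e∈es xu≡xv)) (ℤ.*-zeroʳ (+ x u - + x v))

  edgeProduct-nonzero : ∀ {n} es (x : Vector ℕ n) → (∀ {e} → e ∈ es → x (proj₁ e) ≢ x (proj₂ e)) →
    edgeProduct es x ≢ + 0
  edgeProduct-nonzero []             x proper ()
  edgeProduct-nonzero ((u , v) ∷ es) x proper eq with ℤ.i*j≡0⇒i≡0∨j≡0 (+ x u - + x v) eq
  ... | inj₁ xu-xv≡0 = difference-nonzero (proper (here refl)) xu-xv≡0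
  ... | inj₂ rest≡0  = edgeProduct-nonzero es x (proper ∘ there) rest≡0

module ThreeListColoring where

  open import Data.Nat as ℕ using (ℕ; _≤_)
  import Data.Nat.Properties as ℕ
  open import Data.Fin using (Fin)
  open import Data.Integer using (+_; _*_)
  import Data.Integer.Properties as ℤ
  open import Data.Vec.Functional using (Vector)
  open import Data.List using (List; []; _∷_; length; lookup)
  open import Data.List.Membership.Propositional using (_∈_)
  open import Data.List.Membership.Propositional.Properties using (∈-lookup)
  open import Data.List.Relation.Unary.Any as Any using ()
  open import Data.List.Relation.Unary.Any.Properties using (lookup-index)
  open import Data.List.Relation.Unary.Unique.Propositional using (Unique)
  open import Data.Product using (_×_; _,_; proj₁; proj₂)
  open import Data.Sum using (_⊎_; inj₁; inj₂; [_,_]′)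
  open import Function using (_∘_)
  open import Relation.Nullary using (¬_)
  open import Relation.Nullary.Decidable using (decidable-stable)
  open import Relation.Binary.PropositionalEquality

  open UniqueLists
  open GridSums

  triple : List ℕ → Fin 3 → ℕ
  triple l@(_ ∷ _ ∷ _ ∷ []) = lookup l
  triple _                  = λ _ → 0

  triple-∈ : ∀ {l} → length l ≡ 3 → ∀ i → triple l i ∈ l
  triple-∈ {l@(_ ∷ _ ∷ _ ∷ [])} refl = ∈-lookup {xs = l}

  triple-index : ∀ {l} {x : ℕ} → length l ≡ 3 → x ∈ l → Fin 3
  triple-index {_ ∷ _ ∷ _ ∷ []} refl = Any.index

  triple-index-correct : ∀ {l} {x : ℕ} (|l|≡3 : length l ≡ 3) (x∈l : x ∈ l) →
    triple l (triple-index |l|≡3 x∈l) ≡ x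
  triple-index-correct {_ ∷ _ ∷ _ ∷ []} refl x∈l = sym (lookup-index x∈l)

  triple-injective : ∀ {l} → length l ≡ 3 → Unique l → ∀ i j → triple l i ≡ triple l j → i ≡ j
  triple-injective {_ ∷ _ ∷ _ ∷ []} refl = lookup-injective

  module _ {n} (G : Graph n) (es : List (Fin n × Fin n))
           (es-covers : ∀ u v → Adj G u v → (u , v) ∈ es ⊎ (v , u) ∈ es)
           (es-edges : ∀ {e} → e ∈ es → Adj G (proj₁ e) (proj₂ e)) where

    edgeProduct-nonzero⇒proper : ∀ x → edgeProduct es x ≢ + 0 → ∀ u v → Adj G u v → x u ≢ x v
    edgeProduct-nonzero⇒proper x nonzero u v uv xu≡xv with es-covers u v uv
    ... | inj₁ uv∈es = nonzero (edgeProduct-zero x uv∈es xu≡xv)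
    ... | inj₂ vu∈es = nonzero (edgeProduct-zero x vu∈es (sym xu≡xv))

    uniquely3ListColorable⇒n*2≤edges : UniquelyListColorable G 3 → n ℕ.* 2 ≤ length es
    uniquely3ListColorable⇒n*2≤edges (La , c , (c∈L , c-proper) , c-unique) =
      ℕ.≮⇒≥ λ |es|<2n → [ K≢0 , weight≢0 ]′
        (ℤ.i*j≡0⇒i≡0∨j≡0 K (trans (sym sum-at-c) (gridSum-edgeProduct T es |es|<2n)))
      where
      open ListAssignment La
      T : Vector (Fin 3 → ℕ) n
      T v = triple (L v)
      T-injective : ∀ v i j → T v i ≡ T v j → i ≡ j
      T-injective v = triple-injective (L-size v) (L-unique v)
      ι₀ : Vector (Fin 3) n
      ι₀ v = triple-index {L v} (L-size v) (c∈L v)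
      pick-ι₀ : ∀ v → pick T ι₀ v ≡ c v
      pick-ι₀ v = triple-index-correct (L-size v) (c∈L v)
      K = edgeProduct es c
      K≢0 : K ≢ + 0
      K≢0 = edgeProduct-nonzero es c (λ e∈es → c-proper _ _ (es-edges e∈es))
      weight≢0 : gridWeight (weight ∘ T) ι₀ ≢ + 0
      weight≢0 = product-nonzero _ (λ v → weight-nonzero (T v) (T-injective v) (ι₀ v))
      at-c : ∀ ι → (∀ v → ι v ≡ ι₀ v) → edgeProduct es (pick T ι) ≡ K
      at-c ι ι≗ι₀ = edgeProduct-cong es (λ v → trans (cong (T v) (ι≗ι₀ v)) (pick-ι₀ v))
      elsewhere : ∀ ι → ¬ (∀ v → ι v ≡ ι₀ v) → edgeProduct es (pick T ι) ≡ + 0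
      elsewhere ι ι≉ι₀ = decidable-stable (edgeProduct es (pick T ι) ℤ.≟ + 0) λ nonzero →
        ι≉ι₀ λ v → T-injective v _ _ (trans (pick≗c nonzero v) (sym (pick-ι₀ v)))
        where
        pick≗c : edgeProduct es (pick T ι) ≢ + 0 → ∀ v → pick T ι v ≡ c v
        pick≗c nonzero = c-unique (pick T ι)
          ((λ v → triple-∈ (L-size v) (ι v)) , edgeProduct-nonzero⇒proper (pick T ι) nonzero)
      sum-at-c : gridSum (weight ∘ T) (edgeProduct es ∘ pick T) ≡ K * gridWeight (weight ∘ T) ι₀
      sum-at-c = gridSum-supportedAt (weight ∘ T) _ ι₀ K at-c elsewhere

module EdgeLists {n : ℕ} (G : Graph n) where

  open import Data.Nat as ℕ using (_<_; _<?_)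
  import Data.Nat.Properties as ℕ
  open import Data.Fin as Fin using (Fin; toℕ)
  import Data.Fin.Properties as Fin
  import Data.Bool as Bool
  open import Data.List using (List; length; filter; cartesianProduct; allFin; lookup)
  open import Data.List.Membership.Propositional using (_∈_)
  open import Data.List.Membership.Propositional.Properties
    using (∈-filter⁺; ∈-filter⁻; ∈-cartesianProduct⁺; ∈-allFin; ∈-lookup)
  import Data.List.Relation.Unary.AllPairs.Properties as AllPairs
  open import Data.List.Relation.Unary.Unique.Propositional using (Unique)
  import Data.List.Relation.Unary.Unique.Propositional.Properties as Unique
  open import Data.Product using (_×_; _,_; proj₁; proj₂; swap)
  open import Data.Sum using (_⊎_; inj₁; inj₂)
  open import Data.Empty using (⊥-elim)
  open import Function using (_∘_)
  open import Function.Bundles using (_↣_; mk↣)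
  open import Relation.Binary.Definitions using (tri<; tri≈; tri>)
  open import Relation.Nullary.Decidable using (_×-dec_)
  open import Relation.Unary using (Decidable)
  open import Relation.Binary.PropositionalEquality

  open Graphs
  open UniqueLists

  Oriented : Fin n × Fin n → Set
  Oriented (u , v) = toℕ u < toℕ v × Adj G u v

  oriented? : Decidable Oriented
  oriented? (u , v) = (toℕ u <? toℕ v) ×-dec (Graph.adj G u v Bool.≟ Bool.true)

  edgeList : List (Fin n × Fin n)
  edgeList = filter oriented? (cartesianProduct (allFin n) (allFin n))

  edgeList-unique : Unique edgeList
  edgeList-unique =
    AllPairs.filter⁺ oriented? (Unique.cartesianProduct⁺ (Unique.allFin⁺ n) (Unique.allFin⁺ n))

  edgeList-oriented : ∀ {e} → e ∈ edgeList → Oriented e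
  edgeList-oriented = proj₂ ∘ ∈-filter⁻ oriented? {xs = cartesianProduct (allFin n) (allFin n)}

  edgeList-edges : ∀ {e} → e ∈ edgeList → Adj G (proj₁ e) (proj₂ e)
  edgeList-edges = proj₂ ∘ edgeList-oriented

  edgeList-covers : ∀ u v → Adj G u v → (u , v) ∈ edgeList ⊎ (v , u) ∈ edgeList
  edgeList-covers u v uv with ℕ.<-cmp (toℕ u) (toℕ v)
  ... | tri< u<v _ _ = inj₁ (∈-filter⁺ oriented? (∈-cartesianProduct⁺ (∈-allFin u) (∈-allFin v)) (u<v , uv))
  ... | tri> _ _ v<u =
    inj₂ (∈-filter⁺ oriented? (∈-cartesianProduct⁺ (∈-allFin v) (∈-allFin u)) (v<u , Adj-sym G uv))
  ... | tri≈ _ u≡v _ = ⊥-elim (¬Adj-refl G (subst (Adj G u) (sym (Fin.toℕ-injective u≡v)) uv))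

  edgeDart : Fin (length edgeList) ⊎ Fin (length edgeList) → Dart G
  edgeDart (inj₁ i) = lookup edgeList i , edgeList-edges (∈-lookup i)
  edgeDart (inj₂ i) = swap (lookup edgeList i) , Adj-sym G (edgeList-edges (∈-lookup i))

  bothOrientations : ∀ i j → lookup edgeList i ≢ swap (lookup edgeList j)
  bothOrientations i j eq = ℕ.<-asym (proj₁ (edgeList-oriented (∈-lookup i)))
    (subst (λ e → toℕ (proj₂ e) < toℕ (proj₁ e)) (sym eq) (proj₁ (edgeList-oriented (∈-lookup j))))

  edgeDart-injective : ∀ {x y} → edgeDart x ≡ edgeDart y → x ≡ y
  edgeDart-injective {inj₁ i} {inj₁ j} eq = cong inj₁ (lookup-injective edgeList-unique i j (cong proj₁ eq))
  edgeDart-injective {inj₂ i} {inj₂ j} eq =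
    cong inj₂ (lookup-injective edgeList-unique i j (cong (swap ∘ proj₁) eq))
  edgeDart-injective {inj₁ i} {inj₂ j} eq = ⊥-elim (bothOrientations i j (cong proj₁ eq))
  edgeDart-injective {inj₂ i} {inj₁ j} eq = ⊥-elim (bothOrientations j i (cong proj₁ (sym eq)))

  edgeList-darts : (Fin (length edgeList) ⊎ Fin (length edgeList)) ↣ Dart G
  edgeList-darts = mk↣ edgeDart-injective

module PlaneFaceCounting {n : ℕ} {G : Graph n} (emb : PlaneEmbedding G) where

  open import Data.Nat as ℕ using (ℕ; zero; suc; _+_; _*_; _<_; _≤_; s≤s; _<?_)
  import Data.Nat.Properties as ℕ
  open import Data.Nat.Tactic.RingSolver using (solve-∀)
  open import Data.Fin as Fin using (Fin; zero; suc; toℕ)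
  import Data.Fin.Properties as Fin
  open import Data.Bool using (true)
  import Data.Bool as Bool
  open import Data.Maybe using (just; nothing)
  import Data.Maybe.Properties as Maybe
  open import Data.Unit using (⊤; tt)
  open import Data.Empty using (⊥; ⊥-elim)
  open import Data.Product using (Σ; ∃; _×_; _,_; proj₁; proj₂)
  import Data.Product.Properties as Product
  open import Data.Product.Function.NonDependent.Propositional using (_×-↔_)
  open import Data.Sum using (_⊎_; inj₁; inj₂; [_,_]; map₂)
  open import Data.Sum.Properties using (inj₁-injective; inj₂-injective)
  open import Data.Sum.Function.Propositional using (_⊎-↔_; _⊎-↣_)
  open import Function using (_∘_; _∋_)
  open import Function.Bundles using (Injection; _↣_; _↔_; mk↣)
  open import Function.Definitions using (Injective)
  open import Function.Construct.Composition using (_↣-∘_; _↔-∘_)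
  open import Function.Properties.Inverse using (↔-refl; ↔-sym; ↔⇒↣)
  open import Relation.Nullary using (¬_; Dec; yes; no)
  open import Relation.Nullary.Decidable using (map′; ¬?; _→-dec_; _×-dec_; decidable-stable)
  open import Relation.Binary.Definitions using (DecidableEquality; tri<; tri≈; tri>)
  open import Relation.Binary.PropositionalEquality hiding ([_])
  open import Axiom.UniquenessOfIdentityProofs using (module Decidable⇒UIP)

  open Graphs
  open Iteration
  open SumInjections
  open Graph G
  open PlaneEmbedding emb

  -- Facial walks

  src tgt : Dart G → Fin n
  src = proj₁ ∘ proj₁
  tgt = proj₂ ∘ proj₁

  dart-≡ : ∀ {d d′ : Dart G} → proj₁ d ≡ proj₁ d′ → d ≡ d′
  dart-≡ {_ , p} {_ , q} refl = cong (_ ,_) (Decidable⇒UIP.≡-irrelevant Bool._≟_ p q)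

  _≟ᵈ_ : DecidableEquality (Dart G)
  d ≟ᵈ d′ = map′ dart-≡ (cong proj₁) (Product.≡-dec Fin._≟_ Fin._≟_ (proj₁ d) (proj₁ d′))

  φ-injective : ∀ {d d′ : Dart G} → φ d ≡ φ d′ → d ≡ d′
  φ-injective {(u , v) , uv} {(u′ , v′) , u′v′} eq with cong src eq
  ... | refl = dart-≡ (cong (_, v) (rot-inj v u u′ (Adj-sym G uv) (Adj-sym G u′v′) (cong tgt eq)))

  φ-noFixedPoint : ∀ (d : Dart G) → φ d ≢ d
  φ-noFixedPoint ((u , v) , uv) eq with cong src eq
  ... | refl = ¬Adj-refl G uv

  data WalkLength (d : Dart G) : Set where
    length2  : iter φ 2 d ≡ d → WalkLength d
    length3  : iter φ 2 d ≢ d → iter φ 3 d ≡ d → WalkLength d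
    length≥4 : iter φ 2 d ≢ d → iter φ 3 d ≢ d → WalkLength d

  walkLength : ∀ d → WalkLength d
  walkLength d with iter φ 2 d ≟ᵈ d
  ... | yes ret₂ = length2 ret₂
  ... | no ¬ret₂ with iter φ 3 d ≟ᵈ d
  ...   | yes ret₃ = length3 ¬ret₂ ret₃
  ...   | no ¬ret₃ = length≥4 ¬ret₂ ¬ret₃

  capped : ∀ {d} → WalkLength d → ℕ
  capped (length2 _)    = 2
  capped (length3 _ _)  = 3
  capped (length≥4 _ _) = 4

  2≤capped : ∀ {d} (s : WalkLength d) → 2 ≤ capped s
  2≤capped (length2 _)    = ℕ.≤-refl
  2≤capped (length3 _ _)  = ℕ.n≤1+n 2
  2≤capped (length≥4 _ _) = ℕ.m≤n+m 2 2

  noEarlyReturn : ∀ {d} (s : WalkLength d) k → 0 < k → k < capped s → iter φ k d ≢ d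
  noEarlyReturn s                1 _ _ = φ-noFixedPoint _
  noEarlyReturn (length3 ¬ret₂ _)  2 _ _ = ¬ret₂
  noEarlyReturn (length≥4 ¬ret₂ _) 2 _ _ = ¬ret₂
  noEarlyReturn (length≥4 _ ¬ret₃) 3 _ _ = ¬ret₃
  noEarlyReturn (length2 _)    (suc (suc k))             _ (s≤s (s≤s ()))
  noEarlyReturn (length3 _ _)  (suc (suc (suc k)))       _ (s≤s (s≤s (s≤s ())))
  noEarlyReturn (length≥4 _ _) (suc (suc (suc (suc k)))) _ (s≤s (s≤s (s≤s (s≤s ()))))

  walk-distinct : ∀ {d} (s : WalkLength d) {i j} → i < j → j < capped s → iter φ i d ≢ iter φ j d
  walk-distinct {d} s {i} {j} i<j j< eq =
    noEarlyReturn s (j ℕ.∸ i) (ℕ.m<n⇒0<n∸m i<j) (ℕ.≤-<-trans (ℕ.m∸n≤m j i) j<)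
      (iter-cancel φ φ-injective i (j ℕ.∸ i) d
        (trans eq (cong (λ k → iter φ k d) (sym (ℕ.m+[n∸m]≡n (ℕ.<⇒≤ i<j))))))

  walk-injective : ∀ {d} (s : WalkLength d) i j → i < capped s → j < capped s →
    iter φ i d ≡ iter φ j d → i ≡ j
  walk-injective s i j i< j< eq with ℕ.<-cmp i j
  ... | tri< i<j _ _ = ⊥-elim (walk-distinct s i<j j< eq)
  ... | tri≈ _ i≡j _ = i≡j
  ... | tri> _ _ j<i = ⊥-elim (walk-distinct s j<i i< (sym eq))

  rep : Fin F′ → Dart G
  rep f = proj₁ (Classify.surj faces f)

  faceOf-rep : ∀ f → faceOf (rep f) ≡ f
  faceOf-rep f = proj₂ (Classify.surj faces f)

  faceOf-iter : ∀ k d → faceOf (iter φ k d) ≡ faceOf d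
  faceOf-iter k d = sym (Classify.complete faces d (iter φ k d) (k , refl))

  sameFace⇒iter : ∀ {d d′} → faceOf d ≡ faceOf d′ → ∃ λ k → iter φ k d ≡ d′
  sameFace⇒iter eq = let k , same = Classify.sound faces _ _ eq in k , dart-≡ same

  lengthOf : ∀ f → WalkLength (rep f)
  lengthOf f = walkLength (rep f)

  cappedLength : Fin F′ → ℕ
  cappedLength f = capped (lengthOf f)

  walkDart : Fin F′ → ℕ → Dart G
  walkDart f i = iter φ i (rep f)

  faceOf-walkDart : ∀ f i → faceOf (walkDart f i) ≡ f
  faceOf-walkDart f i = trans (faceOf-iter i (rep f)) (faceOf-rep f)

  walkDart-injective : ∀ {f f′ i i′} → i < cappedLength f → i′ < cappedLength f′ →
    walkDart f i ≡ walkDart f′ i′ → f ≡ f′ × i ≡ i′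
  walkDart-injective {f} {f′} {i} {i′} i< i′< eq
    with trans (sym (faceOf-walkDart f i)) (trans (cong faceOf eq) (faceOf-walkDart f′ i′))
  ... | refl = refl , walk-injective (lengthOf f) i i′ i< i′< eq

  FaceLen3-intro : ∀ f → iter φ 3 (rep f) ≡ rep f → FaceLen3 f
  FaceLen3-intro f ret₃ d fd≡f with sameFace⇒iter (trans (faceOf-rep f) (sym fd≡f))
  ... | k , refl = cong proj₁ (trans (iter-comm φ 3 k (rep f)) (cong (iter φ k) ret₃))

  FaceLen3-elim : ∀ f → FaceLen3 f → iter φ 3 (rep f) ≡ rep f
  FaceLen3-elim f len3 = dart-≡ (len3 (rep f) (faceOf-rep f))

  Deficit : Set
  Deficit = Σ (Fin F′) λ f → Σ (Fin 2) λ k → cappedLength f ≤ 2 + toℕ k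

  deficit-≡ : ∀ {f f′ k k′} {p : cappedLength f ≤ 2 + toℕ k} {p′ : cappedLength f′ ≤ 2 + toℕ k′} →
    f ≡ f′ → k ≡ k′ → (Deficit ∋ (f , k , p)) ≡ (f′ , k′ , p′)
  deficit-≡ {f} {k = k} refl refl = cong (λ p → f , k , p) (ℕ.≤-irrelevant _ _)

  -- Position j of a facial walk is its j-th dart, or a deficit if the walk has length ≤ j.
  facePosition : Fin F′ × (Fin 2 ⊎ Fin 2) → Dart G ⊎ Deficit
  facePosition (f , inj₁ k) = inj₁ (walkDart f (toℕ k))
  facePosition (f , inj₂ k) with 2 + toℕ k <? cappedLength f
  ... | yes _ = inj₁ (walkDart f (2 + toℕ k))
  ... | no ≮  = inj₂ (f , k , ℕ.≮⇒≥ ≮)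

  firstHalf< : ∀ f (k : Fin 2) → toℕ k < cappedLength f
  firstHalf< f k = ℕ.<-≤-trans (Fin.toℕ<n k) (2≤capped (lengthOf f))

  firstHalf≢secondHalf : ∀ f f′ (k k′ : Fin 2) → 2 + toℕ k′ < cappedLength f′ →
    walkDart f (toℕ k) ≢ walkDart f′ (2 + toℕ k′)
  firstHalf≢secondHalf f f′ k k′ k′< eq with walkDart-injective (firstHalf< f k) k′< eq
  ... | _ , k≡2+k′ = ℕ.<⇒≱ (Fin.toℕ<n k) (subst (2 ≤_) (sym k≡2+k′) (ℕ.m≤m+n 2 (toℕ k′)))

  facePosition-injective : ∀ {x y} → facePosition x ≡ facePosition y → x ≡ y
  facePosition-injective {f , inj₁ k} {f′ , inj₁ k′} eq
    with walkDart-injective (firstHalf< f k) (firstHalf< f′ k′) (inj₁-injective eq)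
  ... | refl , k≡k′ = cong (λ k → f , inj₁ k) (Fin.toℕ-injective k≡k′)
  facePosition-injective {f , inj₁ k} {f′ , inj₂ k′} eq with 2 + toℕ k′ <? cappedLength f′
  ... | yes k′< = ⊥-elim (firstHalf≢secondHalf f f′ k k′ k′< (inj₁-injective eq))
  ... | no _ = ⊥-elim (inj₁≢inj₂ eq)
  facePosition-injective {f , inj₂ k} {f′ , inj₁ k′} eq with 2 + toℕ k <? cappedLength f
  ... | yes k< = ⊥-elim (firstHalf≢secondHalf f′ f k′ k k< (sym (inj₁-injective eq)))
  ... | no _ = ⊥-elim (inj₁≢inj₂ (sym eq))
  facePosition-injective {f , inj₂ k} {f′ , inj₂ k′} eq
    with 2 + toℕ k <? cappedLength f | 2 + toℕ k′ <? cappedLength f′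
  ... | yes k< | yes k′< with walkDart-injective k< k′< (inj₁-injective eq)
  ...   | refl , k≡k′ = cong (λ k → f , inj₂ k) (Fin.toℕ-injective (ℕ.+-cancelˡ-≡ 2 _ _ k≡k′))
  facePosition-injective {f , inj₂ k} {f′ , inj₂ k′} eq | no _ | no _ with inj₂-injective eq
  ...   | refl = refl
  facePosition-injective {f , inj₂ k} {f′ , inj₂ k′} eq | yes _ | no _ = ⊥-elim (inj₁≢inj₂ eq)
  facePosition-injective {f , inj₂ k} {f′ , inj₂ k′} eq | no _ | yes _ = ⊥-elim (inj₁≢inj₂ (sym eq))

  -- Components

  HasOuter : Fin C → Set
  HasOuter c = ∃ λ f → outer c ≡ just f

  hasOuter? : ∀ c → Dec (HasOuter c)
  hasOuter? c with outer c
  ... | just f  = yes (f , refl)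
  ... | nothing = no λ ()

  notEdgeless⇒hasOuter : ∀ c → ¬ Edgeless c → HasOuter c
  notEdgeless⇒hasOuter c ¬edgeless with outer c in eq
  ... | just f  = f , refl
  ... | nothing = ⊥-elim (¬edgeless (outer-edges c eq))

  dart-hasOuter : ∀ d → HasOuter (compOf (src d))
  dart-hasOuter d = notEdgeless⇒hasOuter _ λ edgeless → edgeless (src d) refl (tgt d) (proj₂ d)

  reach-isolated : ∀ {u v} → Reach G u v → Isolated G v → u ≡ v
  reach-isolated here          _  = refl
  reach-isolated (step uw w⇝v) iv with reach-isolated w⇝v iv
  ... | refl = ⊥-elim (iv _ (Adj-sym G uw))

  faceComp-rep : ∀ f → faceComp f ≡ compOf (src (rep f))
  faceComp-rep f = trans (cong faceComp (sym (faceOf-rep f))) (faceComp-ok (rep f))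

  isolated-noOuter : ∀ {v} → Isolated G v → ¬ HasOuter (compOf v)
  isolated-noOuter {v} iv (f , outer≡f) =
    iv (tgt (rep f)) (subst (λ x → Adj G x (tgt (rep f))) src≡v (proj₂ (rep f)))
    where
    sameComp : compOf (src (rep f)) ≡ compOf v
    sameComp = trans (sym (faceComp-rep f)) (outer-comp _ f outer≡f)
    src≡v : src (rep f) ≡ v
    src≡v = reach-isolated (Classify.sound comps _ v sameComp) iv

  isolated? : ∀ v → Dec (Isolated G v)
  isolated? v = Fin.all? λ u → ¬? (adj v u Bool.≟ true)

  edgeless? : ∀ c → Dec (Edgeless c)
  edgeless? c = Fin.all? λ v → (compOf v Fin.≟ c) →-dec isolated? v

  rot-fixed⇒onlyNeighbour : ∀ {x y} → Adj G x y → rot x y ≡ y → ∀ w → Adj G x w → w ≡ y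
  rot-fixed⇒onlyNeighbour {x} {y} xy fixed w xw =
    let k , reaches = rot-cyc x y w xy xw in trans (sym reaches) (iter-fixedPoint (rot x) fixed k)

  -- A facial walk of length 2 only occurs in a component consisting of a single edge.
  length2-sameFace : ∀ d → iter φ 2 d ≡ d → ∀ d′ → compOf (src d′) ≡ compOf (src d) →
    faceOf d′ ≡ faceOf d
  length2-sameFace d@((u , v) , uv) ret d′ sameComp =
    onEdge (closed (Classify.sound comps _ _ (sym sameComp)) (inj₁ refl))
    where
    rot-v : rot v u ≡ u
    rot-v = cong src ret
    rot-u : rot u v ≡ v
    rot-u = subst (λ x → rot x v ≡ v) rot-v (cong tgt ret)
    closed : ∀ {x y} → Reach G x y → x ≡ u ⊎ x ≡ v → y ≡ u ⊎ y ≡ v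
    closed here           x∈uv        = x∈uv
    closed (step xw w⇝y) (inj₁ refl) = closed w⇝y (inj₂ (rot-fixed⇒onlyNeighbour uv rot-u _ xw))
    closed (step xw w⇝y) (inj₂ refl) = closed w⇝y (inj₁ (rot-fixed⇒onlyNeighbour (Adj-sym G uv) rot-v _ xw))
    onEdge : src d′ ≡ u ⊎ src d′ ≡ v → faceOf d′ ≡ faceOf d
    onEdge (inj₁ refl) = cong faceOf (dart-≡ (cong (u ,_) (rot-fixed⇒onlyNeighbour uv rot-u _ (proj₂ d′))))
    onEdge (inj₂ refl) = trans (cong faceOf (dart-≡ (cong (v ,_) tgt≡u))) (faceOf-iter 1 d)
      where
      tgt≡u : tgt d′ ≡ rot v u
      tgt≡u = trans (rot-fixed⇒onlyNeighbour (Adj-sym G uv) rot-v _ (proj₂ d′)) (sym rot-v)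

  length2-onlyFace : ∀ f → iter φ 2 (rep f) ≡ rep f → ∀ f′ → faceComp f′ ≡ faceComp f → f′ ≡ f
  length2-onlyFace f ret f′ sameComp = begin
    f′                ≡⟨ sym (faceOf-rep f′) ⟩
    faceOf (rep f′)   ≡⟨ length2-sameFace (rep f) ret (rep f′) sameComp′ ⟩
    faceOf (rep f)    ≡⟨ faceOf-rep f ⟩
    f                 ∎
    where
    open ≡-Reasoning
    sameComp′ : compOf (src (rep f′)) ≡ compOf (src (rep f))
    sameComp′ = trans (sym (faceComp-rep f′)) (trans sameComp (faceComp-rep f))

  length2⇒outer : ∀ f → iter φ 2 (rep f) ≡ rep f → outer (faceComp f) ≡ just f
  length2⇒outer f ret with dart-hasOuter (rep f)
  ... | f₁ , outer≡f₁ = subst (λ c → outer c ≡ just f) (sym (faceComp-rep f)) (trans outer≡f₁ (cong just f₁≡f))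
    where
    f₁≡f : f₁ ≡ f
    f₁≡f = length2-onlyFace f ret f₁ (trans (outer-comp _ f₁ outer≡f₁) (sym (faceComp-rep f)))

  data ShortWalk (f : Fin F′) : Set where
    outerWalk      : ∀ c → outer c ≡ just f → ShortWalk f
    hostWalk       : ∀ c → place c ≡ just f → HasOuter c → ShortWalk f
    triangularFace : TriInner f → ShortWalk f

  notOuter⇒FaceLen3 : ∀ f → cappedLength f ≤ 3 → (∀ c → outer c ≢ just f) → FaceLen3 f
  notOuter⇒FaceLen3 f ≤3 notOuter with lengthOf f
  ... | length2 ret     = ⊥-elim (notOuter _ (length2⇒outer f ret))
  ... | length3 _ ret₃  = FaceLen3-intro f ret₃
  ... | length≥4 _ _    = ⊥-elim (ℕ.<-irrefl refl ≤3)

  shortWalk : ∀ f → cappedLength f ≤ 3 → ShortWalk f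
  shortWalk f ≤3 with Fin.any? (λ c → Maybe.≡-dec Fin._≟_ (outer c) (just f))
  ... | yes (c , outer≡f) = outerWalk c outer≡f
  ... | no notOuter with Fin.any? (λ c → Maybe.≡-dec Fin._≟_ (place c) (just f) ×-dec ¬? (edgeless? c))
  ...   | yes (c , placed , ¬edgeless) = hostWalk c placed (notEdgeless⇒hasOuter c ¬edgeless)
  ...   | no noHost = triangularFace (notOuter′ , notOuter⇒FaceLen3 f ≤3 notOuter′ , guestsEdgeless)
    where
    notOuter′ : ∀ c → outer c ≢ just f
    notOuter′ c outer≡f = notOuter (c , outer≡f)
    guestsEdgeless : ∀ c → place c ≡ just f → Edgeless c
    guestsEdgeless c placed = decidable-stable (edgeless? c) λ ¬edgeless → noHost (c , placed , ¬edgeless)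

  deficit≤3 : ∀ {f} (k : Fin 2) → cappedLength f ≤ 2 + toℕ k → cappedLength f ≤ 3
  deficit≤3 k ≤k = ℕ.≤-trans ≤k (ℕ.+-monoʳ-≤ 2 (ℕ.≤-pred (Fin.toℕ<n k)))

  length3-deficit : ∀ {k : Fin 2} → 3 ≤ 2 + toℕ k → k ≡ suc zero
  length3-deficit {zero}     (s≤s (s≤s ()))
  length3-deficit {suc zero} _ = refl

  length≥4-noDeficit : ∀ {k : Fin 2} → ¬ (4 ≤ 2 + toℕ k)
  length≥4-noDeficit {zero}     (s≤s (s≤s ()))
  length≥4-noDeficit {suc zero} (s≤s (s≤s (s≤s ())))

  triangularFace-deficit : ∀ {f} {k : Fin 2} → TriInner f → cappedLength f ≤ 2 + toℕ k → k ≡ suc zero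
  triangularFace-deficit {f} (_ , len3 , _) ≤k with lengthOf f
  ... | length2 ret₂     = ⊥-elim (φ-noFixedPoint (rep f) (trans (cong φ (sym ret₂)) (FaceLen3-elim f len3)))
  ... | length3 _ _      = length3-deficit ≤k
  ... | length≥4 _ ¬ret₃ = ⊥-elim (¬ret₃ (FaceLen3-elim f len3))

  hostWalk-deficit : ∀ {f c} {k : Fin 2} → place c ≡ just f → cappedLength f ≤ 2 + toℕ k → k ≡ suc zero
  hostWalk-deficit {f} {c} {k} placed ≤k with lengthOf f
  ... | length2 ret₂ = ⊥-elim (place-inner c f placed _ (length2⇒outer f ret₂))
  ... | length3 _ _  = length3-deficit ≤k
  ... | length≥4 _ _ = ⊥-elim (length≥4-noDeficit ≤k)

  -- Charging deficits to components

  -- Every component owns eight slots.  An isolated vertex uses four spare slots of its own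
  -- component; a component with edges takes the deficits of its outer walk (outer slots) and of the
  -- walk it is placed in (host slot), leaving five spare slots for triangular faces and for the
  -- extra token behind the + 1.
  Slot : Set
  Slot = Fin 5 ⊎ Fin 3

  pattern spareSlot i = inj₁ i
  pattern hostSlot    = inj₂ zero
  pattern outerSlot k = inj₂ (suc k)

  dartIndex : Dart G ↣ Fin (2 * E)
  dartIndex = mk↣ {to = Classify.cls darts} λ eq → dart-≡ (Classify.sound darts _ _ eq)

  record Charging : Set where
    field
      charge           : Deficit → Fin C × Slot
      charge-injective : ∀ {t t′} → charge t ≡ charge t′ → t ≡ t′
      charge-hasOuter  : ∀ t → HasOuter (proj₁ (charge t))
      extra            : Fin C × Slot
      extra-hasOuter   : HasOuter (proj₁ extra)
      charge≢extra     : ∀ t → charge t ≢ extra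

  isolatedVertex : Fin I → Fin n
  isolatedVertex i = proj₁ (proj₁ (Classify.surj isolated i))

  isolatedVertex-isolated : ∀ i → Isolated G (isolatedVertex i)
  isolatedVertex-isolated i = proj₂ (proj₁ (Classify.surj isolated i))

  isolatedVertex-injective : ∀ {i i′} → isolatedVertex i ≡ isolatedVertex i′ → i ≡ i′
  isolatedVertex-injective {i} {i′} eq = begin
    i                                                 ≡⟨ sym (proj₂ (Classify.surj isolated i)) ⟩
    Classify.cls isolated (proj₁ (Classify.surj isolated i))  ≡⟨ Classify.complete isolated _ _ eq ⟩
    Classify.cls isolated (proj₁ (Classify.surj isolated i′)) ≡⟨ proj₂ (Classify.surj isolated i′) ⟩
    i′                                                ∎
    where open ≡-Reasoning

  isolatedSlot : Fin I × Fin 4 → Fin C × Slot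
  isolatedSlot (i , j) = compOf (isolatedVertex i) , spareSlot (Fin.inject₁ j)

  isolatedSlot-injective : ∀ {x y} → isolatedSlot x ≡ isolatedSlot y → x ≡ y
  isolatedSlot-injective {i , j} {i′ , j′} eq = cong₂ _,_
    (isolatedVertex-injective
      (reach-isolated (Classify.sound comps _ _ (cong proj₁ eq)) (isolatedVertex-isolated i′)))
    (Fin.inject₁-injective (inj₁-injective (cong proj₂ eq)))

  isolatedSlot-noOuter : ∀ x → ¬ HasOuter (proj₁ (isolatedSlot x))
  isolatedSlot-noOuter (i , _) = isolated-noOuter (isolatedVertex-isolated i)

  module _ (χ : Charging) where

    open Charging χ

    Positions : Set
    Positions = (Fin F′ × (Fin 2 ⊎ Fin 2)) ⊎ ((Fin I × Fin 4) ⊎ ⊤)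

    allocate : Positions → Dart G ⊎ (Fin C × Slot)
    allocate = [ map₂ charge ∘ facePosition , inj₂ ∘ [ isolatedSlot , (λ _ → extra) ] ]

    allocate-injective : Injective _≡_ _≡_ allocate
    allocate-injective = [,]-injective (facePosition-injective ∘ map₂-injective charge-injective)
      (inj₂-injective′ ([,]-injective isolatedSlot-injective (λ _ → refl) isolated≢extra))
      faces≢rest
      where
      inj₂-injective′ : ∀ {A : Set} {h : A → Fin C × Slot} → Injective _≡_ _≡_ h →
        Injective _≡_ _≡_ (inj₂ {A = Dart G} ∘ h)
      inj₂-injective′ h-inj = h-inj ∘ inj₂-injective
      isolated≢extra : ∀ x (_ : ⊤) → isolatedSlot x ≢ extra
      isolated≢extra x _ eq = isolatedSlot-noOuter x (subst HasOuter (sym (cong proj₁ eq)) extra-hasOuter)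
      faces≢rest : ∀ x y → map₂ charge (facePosition x) ≢ inj₂ ([ isolatedSlot , (λ _ → extra) ] y)
      faces≢rest x y eq with facePosition x
      faces≢rest x (inj₁ y) eq | inj₂ t =
        isolatedSlot-noOuter y (subst HasOuter (cong proj₁ (inj₂-injective eq)) (charge-hasOuter t))
      faces≢rest x (inj₂ _) eq | inj₂ t = charge≢extra t (inj₂-injective eq)

    charging⇒4F′+4I<2E+8C : F′ * 4 + (I * 4 + 1) ≤ 2 * E + C * 8
    charging⇒4F′+4I<2E+8C =
      Fin.injective⇒≤ (Injection.injective (target ↣-∘ (mk↣ allocate-injective ↣-∘ source)))
      where
      facePositions : Fin (F′ * 4) ↔ (Fin F′ × (Fin 2 ⊎ Fin 2))
      facePositions = (↔-refl ×-↔ Fin.+↔⊎ {2} {2}) ↔-∘ Fin.*↔× {F′} {4}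
      isolatedPositions : Fin (I * 4 + 1) ↔ ((Fin I × Fin 4) ⊎ ⊤)
      isolatedPositions = (Fin.*↔× ⊎-↔ Fin.1↔⊤) ↔-∘ Fin.+↔⊎
      source : Fin (F′ * 4 + (I * 4 + 1)) ↣ Positions
      source = ↔⇒↣ ((facePositions ⊎-↔ isolatedPositions) ↔-∘ Fin.+↔⊎)
      target : (Dart G ⊎ (Fin C × Slot)) ↣ Fin (2 * E + C * 8)
      target = ↔⇒↣ (↔-sym (Fin.+↔⊎ {2 * E} {C * 8})) ↣-∘ (dartIndex ⊎-↣ slotIndex)
        where
        slotIndex : (Fin C × Slot) ↣ Fin (C * 8)
        slotIndex = ↔⇒↣ (↔-sym (Fin.*↔× {C} {8}) ↔-∘ (↔-refl ×-↔ ↔-sym (Fin.+↔⊎ {5} {3})))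

  IsSpare : Slot → Set
  IsSpare (spareSlot _) = ⊤
  IsSpare (inj₂ _)      = ⊥

  module _ (g : TriFace → Fin 7) (g-injective : ∀ x y → g x ≡ g y → triKey x ≡ triKey y) where

    triangle-≡ : ∀ {f f′} {t : TriInner f} {t′ : TriInner f′} → g (inj₁ (f , t)) ≡ g (inj₁ (f′ , t′)) → f ≡ f′
    triangle-≡ eq = Maybe.just-injective (g-injective _ _ eq)

    -- The seven triangle slots and the extra slot are spare slots of c₁ and c₂.
    module TwoComponents (c₁ c₂ : Fin C) (c₁≢c₂ : c₁ ≢ c₂) (o₁ : HasOuter c₁) (o₂ : HasOuter c₂) where

      triangleSlot : Fin 7 → Fin C × Slot
      triangleSlot s = [ (λ i → c₁ , spareSlot i) , (λ i → c₂ , spareSlot (i Fin.↑ˡ 3)) ] (Fin.splitAt 5 s)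

      triangleSlot-injective : ∀ {s s′} → triangleSlot s ≡ triangleSlot s′ → s ≡ s′
      triangleSlot-injective = Injection.injective (↔⇒↣ (Fin.+↔⊎ {5} {2}))
        ∘ [,]-injective (inj₁-injective ∘ cong proj₂) (Fin.↑ˡ-injective 3 _ _ ∘ inj₁-injective ∘ cong proj₂)
                        (λ _ _ eq → c₁≢c₂ (cong proj₁ eq))

      triangleSlot-spare : ∀ s → IsSpare (proj₂ (triangleSlot s))
      triangleSlot-spare s with Fin.splitAt 5 s
      ... | inj₁ _ = tt
      ... | inj₂ _ = tt

      triangleSlot-hasOuter : ∀ s → HasOuter (proj₁ (triangleSlot s))
      triangleSlot-hasOuter s with Fin.splitAt 5 s
      ... | inj₁ _ = o₁
      ... | inj₂ _ = o₂

      extra : Fin C × Slot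
      extra = c₂ , spareSlot (Fin.fromℕ 4)

      triangleSlot≢extra : ∀ s → triangleSlot s ≢ extra
      triangleSlot≢extra s eq with Fin.splitAt 5 s
      triangleSlot≢extra s eq | inj₁ _           = c₁≢c₂ (cong proj₁ eq)
      triangleSlot≢extra s () | inj₂ zero
      triangleSlot≢extra s () | inj₂ (suc zero)

      chargeWalk : ∀ f → Fin 2 → ShortWalk f → Fin C × Slot
      chargeWalk f k (outerWalk c _)    = c , outerSlot k
      chargeWalk f k (hostWalk c _ _)   = c , hostSlot
      chargeWalk f k (triangularFace t) = triangleSlot (g (inj₁ (f , t)))

      chargeWalk-injective : ∀ {f f′ k k′} (w : ShortWalk f) (w′ : ShortWalk f′) →
        cappedLength f ≤ 2 + toℕ k → cappedLength f′ ≤ 2 + toℕ k′ →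
        chargeWalk f k w ≡ chargeWalk f′ k′ w′ → f ≡ f′ × k ≡ k′
      chargeWalk-injective (outerWalk c e) (outerWalk c′ e′) _ _ eq with cong proj₁ eq
      ... | refl = Maybe.just-injective (trans (sym e) e′) , Fin.suc-injective (inj₂-injective (cong proj₂ eq))
      chargeWalk-injective (hostWalk c p _) (hostWalk c′ p′ _) ≤k ≤k′ eq with cong proj₁ eq
      ... | refl with Maybe.just-injective (trans (sym p) p′)
      ...   | refl = refl , trans (hostWalk-deficit p ≤k) (sym (hostWalk-deficit p′ ≤k′))
      chargeWalk-injective (triangularFace t) (triangularFace t′) ≤k ≤k′ eq
        with triangle-≡ (triangleSlot-injective eq)
      ... | refl = refl , trans (triangularFace-deficit t ≤k) (sym (triangularFace-deficit t′ ≤k′))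
      chargeWalk-injective (outerWalk c e) (hostWalk c′ p′ _) _ _ ()
      chargeWalk-injective (hostWalk c p _) (outerWalk c′ e′) _ _ ()
      chargeWalk-injective {f′ = f′} (outerWalk c e) (triangularFace t′) _ _ eq =
        ⊥-elim (subst IsSpare (sym (cong proj₂ eq)) (triangleSlot-spare (g (inj₁ (f′ , t′)))))
      chargeWalk-injective {f} (triangularFace t) (outerWalk c′ e′) _ _ eq =
        ⊥-elim (subst IsSpare (cong proj₂ eq) (triangleSlot-spare (g (inj₁ (f , t)))))
      chargeWalk-injective {f′ = f′} (hostWalk c p _) (triangularFace t′) _ _ eq =
        ⊥-elim (subst IsSpare (sym (cong proj₂ eq)) (triangleSlot-spare (g (inj₁ (f′ , t′)))))
      chargeWalk-injective {f} (triangularFace t) (hostWalk c′ p′ _) _ _ eq =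
        ⊥-elim (subst IsSpare (cong proj₂ eq) (triangleSlot-spare (g (inj₁ (f , t)))))

      charge : Deficit → Fin C × Slot
      charge (f , k , ≤k) = chargeWalk f k (shortWalk f (deficit≤3 k ≤k))

      charging : Charging
      charging = record
        { charge           = charge
        ; charge-injective = λ { {f , k , ≤k} {f′ , k′ , ≤k′} eq →
            let f≡f′ , k≡k′ = chargeWalk-injective (shortWalk f _) (shortWalk f′ _) ≤k ≤k′ eq
            in deficit-≡ f≡f′ k≡k′ }
        ; charge-hasOuter  = λ { (f , k , ≤k) → walk-hasOuter (shortWalk f (deficit≤3 k ≤k)) }
        ; extra            = extra
        ; extra-hasOuter   = o₂
        ; charge≢extra     = λ { (f , k , ≤k) → walk≢extra (shortWalk f (deficit≤3 k ≤k)) }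
        }
        where
        walk-hasOuter : ∀ {f k} (w : ShortWalk f) → HasOuter (proj₁ (chargeWalk f k w))
        walk-hasOuter (outerWalk c e)    = _ , e
        walk-hasOuter (hostWalk c _ o)   = o
        walk-hasOuter {f} (triangularFace t) = triangleSlot-hasOuter (g (inj₁ (f , t)))
        walk≢extra : ∀ {f k} (w : ShortWalk f) → chargeWalk f k w ≢ extra
        walk≢extra (outerWalk c e)    ()
        walk≢extra (hostWalk c _ o)   ()
        walk≢extra {f} (triangularFace t) = triangleSlot≢extra (g (inj₁ (f , t)))

    -- If c₀ is the only component with edges, no walk hosts a component, so the extra deficit
    -- takes the host slot of c₀, and the triangle slots may use its outer slots: an outer walk of
    -- length 2 makes c₀ a single edge without triangles, and an outer walk of length 3 is then the
    -- unbounded triangular face, charged through g like the others.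
    module OneComponent (c₀ : Fin C) (o₀ : HasOuter c₀) (unique : ∀ c → HasOuter c → c ≡ c₀) where

      faceComp≡c₀ : ∀ f → faceComp f ≡ c₀
      faceComp≡c₀ f = trans (faceComp-rep f) (unique _ (dart-hasOuter (rep f)))

      noHost : ∀ {f c} → place c ≡ just f → HasOuter c → ⊥
      noHost {f} {c} placed o = place-other c f placed (trans (faceComp≡c₀ f) (sym (unique c o)))

      outerWalk-≡ : ∀ {c c′ f f′} → outer c ≡ just f → outer c′ ≡ just f′ → f ≡ f′
      outerWalk-≡ {c} {c′} e e′ = Maybe.just-injective (trans (sym e)
        (trans (cong outer (trans (unique c (_ , e)) (sym (unique c′ (_ , e′))))) e′))

      outerTriangle : ∀ c f → outer c ≡ just f → iter φ 3 (rep f) ≡ rep f → TriUnbounded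
      outerTriangle c f e ret₃ = c , notPlaced , (f , e , FaceLen3-intro f ret₃) , othersEdgeless
        where
        notPlaced : place c ≡ nothing
        notPlaced with place c in placed
        ... | nothing = refl
        ... | just _  = ⊥-elim (noHost placed (_ , e))
        othersEdgeless : ∀ c′ → place c′ ≡ nothing → c′ ≢ c → Edgeless c′
        othersEdgeless c′ _ c′≢c = decidable-stable (edgeless? c′) λ ¬edgeless →
          c′≢c (trans (unique c′ (notEdgeless⇒hasOuter c′ ¬edgeless)) (sym (unique c (_ , e))))

      triangleSlot : Fin 7 → Fin C × Slot
      triangleSlot s = c₀ , [ spareSlot , outerSlot ] (Fin.splitAt 5 s)

      triangleSlot-injective : ∀ {s s′} → triangleSlot s ≡ triangleSlot s′ → s ≡ s′
      triangleSlot-injective = Injection.injective (↔⇒↣ (Fin.+↔⊎ {5} {2}))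
        ∘ [,]-injective inj₁-injective (Fin.suc-injective ∘ inj₂-injective) (λ _ _ ())
        ∘ cong proj₂

      triangleSlot≢host : ∀ s → triangleSlot s ≢ (c₀ , hostSlot)
      triangleSlot≢host s eq with Fin.splitAt 5 s
      triangleSlot≢host s () | inj₁ _
      triangleSlot≢host s () | inj₂ _

      chargeOuter : ∀ f c → outer c ≡ just f → Fin 2 → (s : WalkLength (rep f)) → capped s ≤ 3 → Fin C × Slot
      chargeOuter f c e k (length2 _)       _  = c₀ , outerSlot k
      chargeOuter f c e k (length3 _ ret₃)  _  = triangleSlot (g (inj₂ (outerTriangle c f e ret₃)))
      chargeOuter f c e k (length≥4 _ _)    ≤3 = ⊥-elim (ℕ.<-irrefl refl ≤3)

      chargeWalk : ∀ f (k : Fin 2) → cappedLength f ≤ 3 → ShortWalk f → Fin C × Slot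
      chargeWalk f k ≤3 (outerWalk c e)     = chargeOuter f c e k (lengthOf f) ≤3
      chargeWalk f k ≤3 (hostWalk c p o)    = ⊥-elim (noHost p o)
      chargeWalk f k ≤3 (triangularFace t)  = triangleSlot (g (inj₁ (f , t)))

      chargeOuter-injective : ∀ {f c c′ e e′} {k k′ : Fin 2} (s : WalkLength (rep f)) ≤3 ≤3′ →
        capped s ≤ 2 + toℕ k → capped s ≤ 2 + toℕ k′ →
        chargeOuter f c e k s ≤3 ≡ chargeOuter f c′ e′ k′ s ≤3′ → k ≡ k′
      chargeOuter-injective (length2 _)    _  _ _  _   eq = Fin.suc-injective (inj₂-injective (cong proj₂ eq))
      chargeOuter-injective (length3 _ _)  _  _ ≤k ≤k′ _  = trans (length3-deficit ≤k) (sym (length3-deficit ≤k′))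
      chargeOuter-injective (length≥4 _ _) ≤3 _ _  _   _  = ⊥-elim (ℕ.<-irrefl refl ≤3)

      chargeOuter≢triangle : ∀ {f c e k} (s : WalkLength (rep f)) ≤3 f′ (t′ : TriInner f′) →
        chargeOuter f c e k s ≤3 ≢ triangleSlot (g (inj₁ (f′ , t′)))
      chargeOuter≢triangle {f} {c} {e} (length2 ret₂) _ f′ t′ _ =
        proj₁ t′ c (subst (λ f → outer c ≡ just f) (sym f′≡f) e)
        where
        f′≡f : f′ ≡ f
        f′≡f = length2-onlyFace f ret₂ f′ (trans (faceComp≡c₀ f′) (sym (faceComp≡c₀ f)))
      chargeOuter≢triangle (length3 _ _)  _  f′ t′ eq with g-injective _ _ (triangleSlot-injective eq)
      ... | ()
      chargeOuter≢triangle (length≥4 _ _) ≤3 f′ t′ _  = ℕ.<-irrefl refl ≤3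

      chargeWalk-injective : ∀ {f f′ k k′} ≤3 ≤3′ (w : ShortWalk f) (w′ : ShortWalk f′) →
        cappedLength f ≤ 2 + toℕ k → cappedLength f′ ≤ 2 + toℕ k′ →
        chargeWalk f k ≤3 w ≡ chargeWalk f′ k′ ≤3′ w′ → f ≡ f′ × k ≡ k′
      chargeWalk-injective {f} ≤3 ≤3′ (outerWalk c e) (outerWalk c′ e′) ≤k ≤k′ eq with outerWalk-≡ e e′
      ... | refl = refl , chargeOuter-injective (lengthOf f) ≤3 ≤3′ ≤k ≤k′ eq
      chargeWalk-injective ≤3 ≤3′ (triangularFace t) (triangularFace t′) ≤k ≤k′ eq
        with triangle-≡ (triangleSlot-injective eq)
      ... | refl = refl , trans (triangularFace-deficit t ≤k) (sym (triangularFace-deficit t′ ≤k′))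
      chargeWalk-injective {f} {f′} ≤3 _ (outerWalk c e) (triangularFace t′) _ _ eq =
        ⊥-elim (chargeOuter≢triangle (lengthOf f) ≤3 f′ t′ eq)
      chargeWalk-injective {f} {f′} _ ≤3′ (triangularFace t) (outerWalk c′ e′) _ _ eq =
        ⊥-elim (chargeOuter≢triangle (lengthOf f′) ≤3′ f t (sym eq))
      chargeWalk-injective _ _ (hostWalk c p o) _ _ _ _ = ⊥-elim (noHost p o)
      chargeWalk-injective _ _ _ (hostWalk c p o) _ _ _ = ⊥-elim (noHost p o)

      chargeWalk-component : ∀ {f k} ≤3 (w : ShortWalk f) → proj₁ (chargeWalk f k ≤3 w) ≡ c₀
      chargeWalk-component {f} ≤3 (outerWalk c e) with lengthOf f
      ... | length2 _    = refl
      ... | length3 _ _  = refl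
      ... | length≥4 _ _ = ⊥-elim (ℕ.<-irrefl refl ≤3)
      chargeWalk-component ≤3 (hostWalk c p o)   = ⊥-elim (noHost p o)
      chargeWalk-component ≤3 (triangularFace t) = refl

      chargeWalk≢host : ∀ {f k} ≤3 (w : ShortWalk f) → chargeWalk f k ≤3 w ≢ (c₀ , hostSlot)
      chargeWalk≢host {f} ≤3 (outerWalk c e) with lengthOf f
      ... | length2 _       = λ ()
      ... | length3 _ ret₃  = triangleSlot≢host (g (inj₂ (outerTriangle c f e ret₃)))
      ... | length≥4 _ _    = ⊥-elim (ℕ.<-irrefl refl ≤3)
      chargeWalk≢host ≤3 (hostWalk c p o)       = ⊥-elim (noHost p o)
      chargeWalk≢host {f} ≤3 (triangularFace t) = triangleSlot≢host (g (inj₁ (f , t)))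

      charge : Deficit → Fin C × Slot
      charge (f , k , ≤k) = chargeWalk f k (deficit≤3 k ≤k) (shortWalk f (deficit≤3 k ≤k))

      charging : Charging
      charging = record
        { charge           = charge
        ; charge-injective = λ { {f , k , ≤k} {f′ , k′ , ≤k′} eq →
            let f≡f′ , k≡k′ = chargeWalk-injective _ _ (shortWalk f _) (shortWalk f′ _) ≤k ≤k′ eq
            in deficit-≡ f≡f′ k≡k′ }
        ; charge-hasOuter  = λ { (f , k , ≤k) →
            subst HasOuter (sym (chargeWalk-component _ (shortWalk f (deficit≤3 k ≤k)))) o₀ }
        ; extra            = c₀ , hostSlot
        ; extra-hasOuter   = o₀
        ; charge≢extra     = λ { (f , k , ≤k) → chargeWalk≢host _ (shortWalk f (deficit≤3 k ≤k)) }
        }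

  fewTriangles⇒charging : AtMostTriangular 7 → Dart G → Charging
  fewTriangles⇒charging (g , g-injective) d
    with Fin.any? (λ c → hasOuter? c ×-dec ¬? (c Fin.≟ compOf (src d)))
  ... | yes (c , o , c≢c₀) =
    TwoComponents.charging g g-injective (compOf (src d)) c (c≢c₀ ∘ sym) (dart-hasOuter d) o
  ... | no noOther = OneComponent.charging g g-injective (compOf (src d)) (dart-hasOuter d)
    λ c o → decidable-stable (c Fin.≟ compOf (src d)) λ c≢c₀ → noOther (c , o , c≢c₀)

  fewTriangles⇒2E<4n : AtMostTriangular 7 → Dart G → 2 * E < n * 4
  fewTriangles⇒2E<4n few d = ℕ.+-cancelʳ-≤ (2 * E + C * 8) (suc (2 * E)) (n * 4) (begin
    suc (2 * E) + (2 * E + C * 8)  ≡⟨ rearrange₁ C E ⟩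
    (2 * C + E) * 4 + 1            ≡⟨ cong (λ x → x * 4 + 1) (sym euler) ⟩
    (n + F′ + I) * 4 + 1           ≡⟨ rearrange₂ n F′ I ⟩
    n * 4 + (F′ * 4 + (I * 4 + 1)) ≤⟨ ℕ.+-monoʳ-≤ (n * 4) count ⟩
    n * 4 + (2 * E + C * 8)        ∎)
    where
    open ℕ.≤-Reasoning
    count : F′ * 4 + (I * 4 + 1) ≤ 2 * E + C * 8
    count = charging⇒4F′+4I<2E+8C (fewTriangles⇒charging few d)
    rearrange₁ : ∀ c e → suc (2 * e) + (2 * e + c * 8) ≡ (2 * c + e) * 4 + 1
    rearrange₁ = solve-∀
    rearrange₂ : ∀ n f i → (n + f + i) * 4 + 1 ≡ n * 4 + (f * 4 + (i * 4 + 1))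
    rearrange₂ = solve-∀

module _ {n : ℕ} (G : Graph n) where

  open import Data.Nat as ℕ using (_<_; _+_; _*_)
  import Data.Nat.Properties as ℕ
  open import Data.Nat.Tactic.RingSolver using (solve-∀)
  import Data.Fin as Fin
  import Data.Fin.Properties as Fin
  open import Data.List using (length)
  open import Data.Sum using (inj₁)
  open import Function.Bundles using (Injection)
  open import Function.Construct.Composition using (_↣-∘_)
  open import Function.Properties.Inverse using (↔⇒↣)
  open import Relation.Binary.PropositionalEquality
  open EdgeLists G
  open ThreeListColoring

  emptyGraph-uniquelyListColorable : n ≡ 0 → ∀ k → UniquelyListColorable G k
  emptyGraph-uniquelyListColorable refl k =
    record { L = λ () ; L-size = λ () ; L-unique = λ () } , (λ ()) , ((λ ()) , (λ ())) , (λ _ _ ())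

  module _ (emb : PlaneEmbedding G) where

    open PlaneEmbedding emb using (E; AtMostTriangular)
    open PlaneFaceCounting emb using (dartIndex; fewTriangles⇒2E<4n)

    edgeList-length : length edgeList + length edgeList ≤ 2 * E
    edgeList-length = Fin.injective⇒≤ (Injection.injective (dartIndex ↣-∘ (edgeList-darts ↣-∘ ↔⇒↣ Fin.+↔⊎)))

    fewTriangles∧uniquely3ListColorable⇒empty : AtMostTriangular 7 → UniquelyListColorable G 3 → n ≡ 0
    fewTriangles∧uniquely3ListColorable⇒empty few ulc =
      ℕ.n≤0⇒n≡0 (ℕ.≮⇒≥ λ 0<n → ℕ.<-irrefl refl (begin-strict
      n * 4                                ≡⟨ double n ⟩
      n * 2 + n * 2                        ≤⟨ ℕ.+-mono-≤ 2n≤|edges| 2n≤|edges| ⟩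
      length edgeList + length edgeList    ≤⟨ edgeList-length ⟩
      2 * E                                <⟨ fewTriangles⇒2E<4n few (someDart 0<n) ⟩
      n * 4                                ∎))
      where
      open ℕ.≤-Reasoning
      double : ∀ n → n * 4 ≡ n * 2 + n * 2
      double = solve-∀
      2n≤|edges| : n * 2 ≤ length edgeList
      2n≤|edges| = uniquely3ListColorable⇒n*2≤edges G edgeList edgeList-covers edgeList-edges ulc
      someDart : 0 < n → Dart G
      someDart 0<n = edgeDart (inj₁ (Fin.fromℕ< (ℕ.<-≤-trans 0<n (ℕ.≤-trans (ℕ.m≤m*n n 2) 2n≤|edges|))))

proposition10 : ∀ (n : ℕ) (G : Graph n) (emb : PlaneEmbedding G) →
    PlaneEmbedding.AtMostTriangular emb 7 →
    ∀ m → IsMNumber G m → m ≤ 3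
proposition10 n G emb few m (_ , ¬uniquely-m , uniquely-below) =
  decidable-stable (m ≤? 3) λ m≰3 →
    ¬uniquely-m (emptyGraph-uniquelyListColorable G
      (fewTriangles∧uniquely3ListColorable⇒empty G emb few (uniquely-below 3 (s≤s z≤n) (≰⇒> m≰3))) m)
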